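{- For every digraph $G$, $kpw(G)=dpw(G)$.
   Context: All digraphs are finite and simple. A directed path graph is a DAG whose nodes can be numbered $1,\dots,l$ with arcs exactly $(i,i+1)$ for $1\le i<l$. For $W,X\subseteq V(G)$, $X$ guards $W$ if $W\cap X=\emptyset$ and for every arc $(u,v)$ of $G$ with $u\in W$ we have $v\in W\cup X$. For sets indexed by nodes $1,\dots,l$, write $W_{\ge i}=\bigcup_{k\ge i}W_k$. A directed path decomposition of $G$ is a directed path graph $T$ on nodes $1,\dots,l$ together with subsets $W_1,\dots,W_l$ of $V(G)$ such that: (1) $\bigcup_i W_i=V(G)$; (2) for $i\le j\le k$, $W_i\cap W_k\subseteq W_j$; (3) for each $1\le i<l$, $W_i\cap W_{i+1}$ guards $W_{\ge i+1}\setminus W_i$, and $W_{\ge 1}$ is guarded by $\emptyset$. Its width is $\max_i|W_i|$; $dpw(G)$ is the minimum width. A Kelly path decomposition of $G$ is a directed path graph $T$ on nodes $1,\dots,l$ together with subsets $W_1,\dots,W_l$ and $X_1,\dots,X_l$ of $V(G)$ such that: (1) $W_1,\dots,W_l$ form a partition of $V(G)$; (2) for each $i$, $X_i$ guards $W_{\ge i}$; (3) for each $1\le i<l$, $X_{i+1}\subseteq W_i\cup X_i$. Its width is $\max_i|W_i\cup X_i|$; the Kelly pathwidth $kpw(G)$ is the minimum width of a Kelly path decomposition of $G$. -}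

module Defs where

open import Data.Nat using (ℕ; _≤_; _⊔_)
open import Data.Bool using (Bool; true)
open import Data.Fin using (Fin; toℕ)
open import Data.Fin.Subset using (Subset; _∈_; _∪_; ∣_∣)
open import Data.List using (foldr; map; allFin)
open import Data.Product using (Σ; ∃; ∃-syntax; _×_)
open import Data.Sum using (_⊎_)
open import Data.Empty using (⊥)
open import Relation.Nullary using (¬_)
open import Relation.Binary.PropositionalEquality using (_≡_)

record Digraph : Set where
  field
    n        : ℕ
    arc      : Fin n → Fin n → Bool
    loopless : ∀ v → ¬ (arc v v ≡ true)
open Digraph public

Guards : (G : Digraph) → (Fin (n G) → Set) → (Fin (n G) → Set) → Set
Guards G W X =
  (∀ v → W v → X v → ⊥) ×
  (∀ u v → arc G u v ≡ true → W u → W v ⊎ X v)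

W≥ : ∀ {m l} → (Fin l → Subset m) → Fin l → Fin m → Set
W≥ W i v = ∃[ k ] (toℕ i ≤ toℕ k × v ∈ W k)

maxOver : ∀ {l} → (Fin l → ℕ) → ℕ
maxOver {l} f = foldr _⊔_ 0 (map f (allFin l))

-- Directed path decomposition; nodes 1..l are Fin l (0-based).
record DPD (G : Digraph) : Set where
  field
    l      : ℕ
    l≥1    : 1 ≤ l
    W      : Fin l → Subset (n G)
    cover  : ∀ v → ∃[ i ] (v ∈ W i)
    interp : ∀ i j k → toℕ i ≤ toℕ j → toℕ j ≤ toℕ k →
             ∀ v → v ∈ W i → v ∈ W k → v ∈ W j
    guard  : ∀ i j → toℕ j ≡ Data.Nat.suc (toℕ i) →
             Guards G (λ v → W≥ W j v × ¬ (v ∈ W i))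
                      (λ v → v ∈ W i × v ∈ W j)
    guard₁ : Guards G (λ v → ∃[ i ] (v ∈ W i)) (λ _ → ⊥)

dpdWidth : ∀ {G} → DPD G → ℕ
dpdWidth D = maxOver (λ i → ∣ W i ∣) where open DPD D

record KPD (G : Digraph) : Set where
  field
    l      : ℕ
    l≥1    : 1 ≤ l
    W      : Fin l → Subset (n G)
    X      : Fin l → Subset (n G)
    cover  : ∀ v → ∃[ i ] (v ∈ W i)
    disj   : ∀ i j v → v ∈ W i → v ∈ W j → i ≡ j
    guard  : ∀ i → Guards G (W≥ W i) (λ v → v ∈ X i)
    mono   : ∀ i j → toℕ j ≡ Data.Nat.suc (toℕ i) →
             ∀ v → v ∈ X j → v ∈ (W i ∪ X i)

kpdWidth : ∀ {G} → KPD G → ℕ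
kpdWidth D = maxOver (λ i → ∣ W i ∪ X i ∣) where open KPD D

IsDpw : Digraph → ℕ → Set
IsDpw G k = (∃[ D ] (dpdWidth {G} D ≡ k)) × (∀ (D : DPD G) → k ≤ dpdWidth D)

IsKpw : Digraph → ℕ → Set
IsKpw G k = (∃[ D ] (kpdWidth {G} D ≡ k)) × (∀ (D : KPD G) → k ≤ kpdWidth D)

module Submission where

open import Defs
open import Data.Nat using (ℕ; zero; suc; _≤_; _<_; _⊔_; z≤n; s≤s; _∸_; _+_; _<?_; _≤?_)
open import Data.Nat.Properties
open import Data.Product using (_×_; _,_; proj₁; proj₂; ∃-syntax)
open import Data.Sum using (_⊎_; inj₁; inj₂)
open import Data.Bool using (true)
open import Data.Fin using (Fin; toℕ; inject₁) renaming (zero to fzero; suc to fsuc)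
open import Data.Fin.Properties using (toℕ-inject₁; toℕ-injective; toℕ<n; any?)
open import Data.Fin.Subset using (Subset; _∈_; _∉_; _∪_; _⊆_)
open import Data.Fin.Subset.Properties using (x∈p∪q⁺; x∈p∪q⁻; p⊆q⇒∣p∣≤∣q∣; _∈?_)
open import Data.List using ([]; _∷_; foldr; map; allFin)
open import Data.Vec using (tabulate)
open import Data.Vec.Properties using (lookup∘tabulate; []=⇒lookup; lookup⇒[]=)
open import Function using (_∘_)
open import Relation.Nullary using (¬_; yes; no; contradiction)
open import Relation.Nullary.Decidable using (does; dec-true; _×-dec_; ¬?)
open import Relation.Unary using (Decidable)
open import Relation.Binary.PropositionalEquality using (_≡_; refl; sym; trans; cong; subst)
open import Relation.Binary using (tri<; tri≈; tri>)

-- A Kelly decomposition (W, X) yields the directed decomposition with bags W i ∪ X i: since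
-- X (i+1) ⊆ W i ∪ X i, a vertex of a bag can be traced back bag by bag until it lies in some W m,
-- and X i guarding W≥ i keeps it out of all bags before m; this gives interpolation and the
-- guarding condition, with the same width. Conversely, splitting each bag D i of a directed
-- decomposition into the vertices occurring there for the first time (W i) and those already
-- seen earlier (X i) yields a Kelly decomposition whose i-th set W i ∪ X i is D i itself.
-- Widths can thus be transported both ways without increase, so the two minima coincide.

IsMinimum : {A : Set} → (A → ℕ) → ℕ → Set
IsMinimum {A} width k = (∃[ a ] (width a ≡ k)) × (∀ (a : A) → k ≤ width a)

isMinimum-transfer : {A B : Set} {widthᴬ : A → ℕ} {widthᴮ : B → ℕ} {k : ℕ} →
                     (f : A → B) (g : B → A) →
                     (∀ a → widthᴮ (f a) ≤ widthᴬ a) → (∀ b → widthᴬ (g b) ≤ widthᴮ b) →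
                     IsMinimum widthᴬ k → IsMinimum widthᴮ k
isMinimum-transfer f g f-≤ g-≤ ((a , width≡k) , minimal) =
  (f a , ≤-antisym (≤-trans (f-≤ a) (≤-reflexive width≡k))
                   (≤-trans (minimal (g (f a))) (g-≤ (f a)))) ,
  λ b → ≤-trans (minimal (g b)) (g-≤ b)

maxOver-mono : ∀ {l} {f g : Fin l → ℕ} → (∀ i → f i ≤ g i) → maxOver f ≤ maxOver g
maxOver-mono {l} {f} {g} f≤g = foldr-mono (allFin l)
  where
  foldr-mono : ∀ is → foldr _⊔_ 0 (map f is) ≤ foldr _⊔_ 0 (map g is)
  foldr-mono []       = z≤n
  foldr-mono (i ∷ is) = ⊔-mono-≤ (f≤g i) (foldr-mono is)

toℕ-fsuc-inject₁ : ∀ {m} (i : Fin m) → toℕ (fsuc i) ≡ suc (toℕ (inject₁ i))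
toℕ-fsuc-inject₁ i = cong suc (sym (toℕ-inject₁ i))

fromDec : ∀ {m} {P : Fin m → Set} → Decidable P → Subset m
fromDec P? = tabulate (λ v → does (P? v))

∈-fromDec⁺ : ∀ {m} {P : Fin m → Set} (P? : Decidable P) {v} → P v → v ∈ fromDec P?
∈-fromDec⁺ P? {v} p = lookup⇒[]= v _ (trans (lookup∘tabulate _ v) (dec-true (P? v) p))

∈-fromDec⁻ : ∀ {m} {P : Fin m → Set} (P? : Decidable P) {v} → v ∈ fromDec P? → P v
∈-fromDec⁻ P? {v} v∈ with P? v | trans (sym (lookup∘tabulate _ v)) ([]=⇒lookup v∈)
... | yes p | _  = p
... | no _  | ()

module KellyToDirected {G : Digraph} (K : KPD G) where
  open KPD K

  bag : Fin l → Subset (n G)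
  bag i = W i ∪ X i

  ∈bag⇒∈earlierBag⊎∈laterW : ∀ {j k v} → toℕ j ≤ toℕ k → v ∈ bag k →
                             v ∈ bag j ⊎ ∃[ m ] (toℕ j < toℕ m × v ∈ W m)
  ∈bag⇒∈earlierBag⊎∈laterW {j} {k} j≤k = trace (toℕ k ∸ toℕ j) k (sym (m∸n+n≡m j≤k))
    where
    trace : ∀ d k {v} → toℕ k ≡ d + toℕ j → v ∈ bag k →
            v ∈ bag j ⊎ ∃[ m ] (toℕ j < toℕ m × v ∈ W m)
    trace zero    k k≡j v∈k = inj₁ (subst (λ i → _ ∈ bag i) (toℕ-injective k≡j) v∈k)
    trace (suc d) k k≡ v∈k with x∈p∪q⁻ (W k) (X k) v∈k
    ... | inj₁ v∈W = inj₂ (k , subst (toℕ j <_) (sym k≡) (s≤s (m≤n+m (toℕ j) d)) , v∈W)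
    trace (suc d) (fsuc k) k≡ v∈k | inj₂ v∈X =
      trace d (inject₁ k) (suc-injective (trans (sym (toℕ-fsuc-inject₁ k)) k≡))
            (mono (inject₁ k) (fsuc k) (toℕ-fsuc-inject₁ k) _ v∈X)

  ∈laterW⇒∉bag : ∀ {i m v} → toℕ i < toℕ m → v ∈ W m → v ∉ bag i
  ∈laterW⇒∉bag {i} {m} i<m v∈Wm v∈i with x∈p∪q⁻ (W i) (X i) v∈i
  ... | inj₁ v∈Wi = <-irrefl (cong toℕ (disj i m _ v∈Wi v∈Wm)) i<m
  ... | inj₂ v∈Xi = proj₁ (guard i) _ (m , <⇒≤ i<m , v∈Wm) v∈Xi

  bag-interp : ∀ i j k → toℕ i ≤ toℕ j → toℕ j ≤ toℕ k →
               ∀ v → v ∈ bag i → v ∈ bag k → v ∈ bag j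
  bag-interp i j k i≤j j≤k v v∈i v∈k with ∈bag⇒∈earlierBag⊎∈laterW j≤k v∈k
  ... | inj₁ v∈j             = v∈j
  ... | inj₂ (m , j<m , v∈W) = contradiction v∈i (∈laterW⇒∉bag (≤-<-trans i≤j j<m) v∈W)

  bag-guard : ∀ i j → toℕ j ≡ suc (toℕ i) →
              Guards G (λ v → W≥ bag j v × v ∉ bag i) (λ v → v ∈ bag i × v ∈ bag j)
  bag-guard i j j≡1+i = (λ v u∈ v∈ → proj₂ u∈ (proj₁ v∈)) , step
    where
    ∈W≥ : ∀ {u} → W≥ bag j u → u ∉ bag i → W≥ W j u
    ∈W≥ (k , j≤k , u∈k) u∉i with ∈bag⇒∈earlierBag⊎∈laterW j≤k u∈k
    ... | inj₂ (m , j<m , u∈W) = m , <⇒≤ j<m , u∈W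
    ... | inj₁ u∈j with x∈p∪q⁻ (W j) (X j) u∈j
    ...   | inj₁ u∈W = j , ≤-refl , u∈W
    ...   | inj₂ u∈X = contradiction (mono i j j≡1+i _ u∈X) u∉i
    step : ∀ u v → arc G u v ≡ true → W≥ bag j u × u ∉ bag i →
           (W≥ bag j v × v ∉ bag i) ⊎ (v ∈ bag i × v ∈ bag j)
    step u v uv (u∈ , u∉i) with proj₂ (guard j) u v uv (∈W≥ u∈ u∉i)
    ... | inj₂ v∈X = inj₂ (mono i j j≡1+i v v∈X , x∈p∪q⁺ (inj₂ v∈X))
    ... | inj₁ (p , j≤p , v∈W) =
      inj₁ ((p , j≤p , x∈p∪q⁺ (inj₁ v∈W)) ,
            ∈laterW⇒∉bag (subst (_≤ toℕ p) j≡1+i j≤p) v∈W)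

  bag-cover : ∀ v → ∃[ i ] (v ∈ bag i)
  bag-cover v = proj₁ (cover v) , x∈p∪q⁺ (inj₁ (proj₂ (cover v)))

  toDPD : DPD G
  toDPD = record
    { l = l ; l≥1 = l≥1 ; W = bag
    ; cover = bag-cover
    ; interp = bag-interp
    ; guard = bag-guard
    ; guard₁ = (λ _ _ ()) , λ _ v _ _ → inj₁ (bag-cover v)
    }

  toDPD-width : dpdWidth toDPD ≡ kpdWidth K
  toDPD-width = refl

module DirectedToKelly {G : Digraph} (D : DPD G) where
  open DPD D renaming (W to bag)

  OccursBefore : Fin l → Fin (n G) → Set
  OccursBefore i v = ∃[ j ] (toℕ j < toℕ i × v ∈ bag j)

  occursBefore? : ∀ i → Decidable (OccursBefore i)
  occursBefore? i v = any? (λ j → (toℕ j <? toℕ i) ×-dec (v ∈? bag j))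

  IsNewAt IsOldAt : Fin l → Fin (n G) → Set
  IsNewAt i v = v ∈ bag i × ¬ OccursBefore i v
  IsOldAt i v = v ∈ bag i × OccursBefore i v

  isNewAt? : ∀ i → Decidable (IsNewAt i)
  isNewAt? i v = (v ∈? bag i) ×-dec ¬? (occursBefore? i v)
  isOldAt? : ∀ i → Decidable (IsOldAt i)
  isOldAt? i v = (v ∈? bag i) ×-dec occursBefore? i v

  new old : Fin l → Subset (n G)
  new i = fromDec (isNewAt? i)
  old i = fromDec (isOldAt? i)

  ∈new⁺ : ∀ {i v} → IsNewAt i v → v ∈ new i
  ∈new⁺ {i} = ∈-fromDec⁺ (isNewAt? i)

  ∈new⁻ : ∀ {i v} → v ∈ new i → IsNewAt i v
  ∈new⁻ {i} = ∈-fromDec⁻ (isNewAt? i)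

  ∈old⁺ : ∀ {i v} → IsOldAt i v → v ∈ old i
  ∈old⁺ {i} = ∈-fromDec⁺ (isOldAt? i)

  ∈old⁻ : ∀ {i v} → v ∈ old i → IsOldAt i v
  ∈old⁻ {i} = ∈-fromDec⁻ (isOldAt? i)

  firstOccurrence : ∀ {i v} → v ∈ bag i → ∃[ f ] (toℕ f ≤ toℕ i × IsNewAt f v)
  firstOccurrence {i} = search l i (toℕ<n i)
    where
    search : ∀ fuel i {v} → toℕ i < fuel → v ∈ bag i → ∃[ f ] (toℕ f ≤ toℕ i × IsNewAt f v)
    search (suc fuel) i {v} i<fuel v∈i with occursBefore? i v
    ... | no never = i , ≤-refl , v∈i , never
    ... | yes (j , j<i , v∈j) with search fuel j (<-≤-trans j<i (≤-pred i<fuel)) v∈j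
    ...   | f , f≤j , isNew = f , ≤-trans f≤j (<⇒≤ j<i) , isNew

  firstOccurrence-after : ∀ {j p v} → toℕ j ≤ toℕ p → v ∈ bag p → v ∉ bag j →
                          ∃[ f ] (toℕ j < toℕ f × IsNewAt f v)
  firstOccurrence-after {j} {p} j≤p v∈p v∉j with firstOccurrence v∈p
  ... | f , f≤p , isNew with toℕ f ≤? toℕ j
  ...   | yes f≤j = contradiction (interp f j p f≤j j≤p _ (proj₁ isNew) v∈p) v∉j
  ...   | no  f≰j = f , ≰⇒> f≰j , isNew

  new-cover : ∀ v → ∃[ i ] (v ∈ new i)
  new-cover v with firstOccurrence (proj₂ (cover v))
  ... | f , _ , isNew = f , ∈new⁺ isNew

  new-disjoint : ∀ i j v → v ∈ new i → v ∈ new j → i ≡ j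
  new-disjoint i j v v∈i v∈j
    with ∈new⁻ v∈i | ∈new⁻ v∈j | <-cmp (toℕ i) (toℕ j)
  ... | (v∈bag , _) | (_ , notBefore) | tri< i<j _ _ = contradiction (i , i<j , v∈bag) notBefore
  ... | _           | _               | tri≈ _ i≡j _ = toℕ-injective i≡j
  ... | (_ , notBefore) | (v∈bag , _) | tri> _ _ j<i = contradiction (j , j<i , v∈bag) notBefore

  old-disjoint-new≥ : ∀ i v → W≥ new i v → v ∉ old i
  old-disjoint-new≥ i v (k , i≤k , v∈k) v∈old with ∈new⁻ v∈k | ∈old⁻ v∈old
  ... | (_ , notBefore) | (_ , (j , j<i , v∈j)) = notBefore (j , <-≤-trans j<i i≤k , v∈j)

  old-guards-new≥-suc : ∀ j i → toℕ i ≡ suc (toℕ j) → ∀ u v → arc G u v ≡ true →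
                          W≥ new i u → W≥ new i v ⊎ v ∈ old i
  old-guards-new≥-suc j i i≡1+j u v uv (k , i≤k , u∈k) with ∈new⁻ u∈k
  ... | (u∈bag , notBefore)
    with proj₂ (guard j i i≡1+j) u v uv
               ((k , i≤k , u∈bag) ,
                λ u∈j → notBefore (j , subst (_≤ toℕ k) i≡1+j i≤k , u∈j))
  ...   | inj₂ (v∈j , v∈i) = inj₂ (∈old⁺ (v∈i , (j , ≤-reflexive (sym i≡1+j) , v∈j)))
  ...   | inj₁ ((p , i≤p , v∈p) , v∉j)
    with firstOccurrence-after (<⇒≤ (subst (_≤ toℕ p) i≡1+j i≤p)) v∈p v∉j
  ...     | f , j<f , isNew = inj₁ (f , subst (_≤ toℕ f) (sym i≡1+j) j<f , ∈new⁺ isNew)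

  old-guards-new≥ : ∀ i u v → arc G u v ≡ true → W≥ new i u → W≥ new i v ⊎ v ∈ old i
  old-guards-new≥ fzero u v _ _ with new-cover v
  ... | f , v∈f = inj₁ (f , z≤n , v∈f)
  old-guards-new≥ (fsuc i) = old-guards-new≥-suc (inject₁ i) (fsuc i) (toℕ-fsuc-inject₁ i)

  old-mono : ∀ i j → toℕ j ≡ suc (toℕ i) → ∀ v → v ∈ old j → v ∈ (new i ∪ old i)
  old-mono i j j≡1+i v v∈old with ∈old⁻ v∈old
  ... | (v∈j , (j' , j'<j , v∈j'))
    with interp j' i j (≤-pred (subst (toℕ j' <_) j≡1+i j'<j))
                (≤-trans (n≤1+n (toℕ i)) (≤-reflexive (sym j≡1+i))) v v∈j' v∈j
  ...   | v∈i with occursBefore? i v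
  ...     | yes before = x∈p∪q⁺ (inj₂ (∈old⁺ (v∈i , before)))
  ...     | no  never  = x∈p∪q⁺ (inj₁ (∈new⁺ (v∈i , never)))

  toKPD : KPD G
  toKPD = record
    { l = l ; l≥1 = l≥1 ; W = new ; X = old
    ; cover = new-cover ; disj = new-disjoint
    ; guard = λ i → old-disjoint-new≥ i , old-guards-new≥ i ; mono = old-mono }

  new∪old⊆bag : ∀ i → new i ∪ old i ⊆ bag i
  new∪old⊆bag i v∈ with x∈p∪q⁻ (new i) (old i) v∈
  ... | inj₁ v∈new = proj₁ (∈new⁻ v∈new)
  ... | inj₂ v∈old = proj₁ (∈old⁻ v∈old)

  toKPD-width : kpdWidth toKPD ≤ dpdWidth D
  toKPD-width = maxOver-mono (λ i → p⊆q⇒∣p∣≤∣q∣ (new∪old⊆bag i))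

mainTheorem5 : (G : Digraph) (k : ℕ) → (IsKpw G k → IsDpw G k) × (IsDpw G k → IsKpw G k)
mainTheorem5 G k =
  isMinimum-transfer KellyToDirected.toDPD DirectedToKelly.toKPD
                     (≤-reflexive ∘ KellyToDirected.toDPD-width) DirectedToKelly.toKPD-width ,
  isMinimum-transfer DirectedToKelly.toKPD KellyToDirected.toDPD
                     DirectedToKelly.toKPD-width (≤-reflexive ∘ KellyToDirected.toDPD-width)
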